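{- Let $k\ge1$ be an integer. There is no set $\mathcal{F}$ of maps (forbidden submaps) such that for every map $\varepsilon\colon X^{\times}_{\mathrm{irr}}\to\mathcal{P}(M)$ (over arbitrary finite nonempty $X$ and $M$), $\varepsilon$ is a $k$-restricted Fitch map if and only if $\varepsilon$ does not contain a submap belonging to $\mathcal{F}$.
   Context: For finite nonempty sets $X$ (leaves) and $M$ (colors), $X^{\times}_{\mathrm{irr}}=\{(x,y)\in X\times X: x\neq y\}$. A phylogenetic tree on $X$ is a rooted tree whose leaves (non-root vertices of degree $1$) form $X$, whose root has degree $\ge2$ and whose non-root inner vertices have degree $\ge3$; $\mathrm{lca}(x,y)$ is the last common ancestor. An edge-labeled tree $(T,\lambda)$ on $X$ with $M$ is a phylogenetic tree $T$ on $X$ with $\lambda\colon E(T)\to\mathcal{P}(M)$; $e$ is an $m$-edge if $m\in\lambda(e)$. $(T,\lambda)$ explains $\varepsilon\colon X^{\times}_{\mathrm{irr}}\to\mathcal{P}(M)$ if for all $(x,y)\in X^{\times}_{\mathrm{irr}}$, $m\in M$: $m\in\varepsilon(x,y)$ iff the path from $\mathrm{lca}(x,y)$ to $y$ contains an $m$-edge; $\varepsilon$ is a $k$-restricted Fitch map if some edge-labeled tree $(T,\lambda)$ with $|\lambda(e)|\le k$ for all $e\in E(T)$ explains it. A map $\varepsilon'\colon X'^{\times}_{\mathrm{irr}}\to\mathcal{P}(M')$ is a submap of $\varepsilon$ if $X'\subseteq X$ and $\varepsilon'(x,y)\subseteq\varepsilon(x,y)$ for all $(x,y)\in X'^{\times}_{\mathrm{irr}}$.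 -}

module Defs where

open import Data.Nat using (ℕ; _≤_)
open import Data.Fin using (Fin)
open import Data.List using (List; []; _∷_; _++_; length; lookup)
open import Data.List.Membership.Propositional using (_∈_)
open import Data.List.Relation.Unary.All using (All)
open import Data.List.Relation.Unary.Unique.Propositional using (Unique)
open import Data.List.Relation.Binary.Permutation.Propositional using (_↭_)
open import Data.Product using (Σ; ∃; _×_; _,_; proj₁; proj₂)
open import Data.Sum using (_⊎_)
open import Data.Unit using (⊤)
open import Relation.Binary.PropositionalEquality using (_≡_; _≢_)
open import Relation.Nullary using (¬_)
open import Function.Bundles using (_⇔_)

-- Leaves and colours are drawn from the common universe ℕ; finite sets are
-- lists (membership _∈_ gives set semantics).

-- An edge-labelled rooted tree: a leaf, or an inner vertex with a list of
-- children, each child given together with the label λ(e) (a finite set of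
-- colours, as a list) of the edge from the vertex to that child.
data Tree : Set where
  leaf : ℕ → Tree
  node : List (List ℕ × Tree) → Tree

Child : Set
Child = List ℕ × Tree

mutual
  leaves : Tree → List ℕ
  leaves (leaf x) = x ∷ []
  leaves (node cs) = leavesL cs

  leavesL : List Child → List ℕ
  leavesL [] = []
  leavesL ((l , c) ∷ cs) = leaves c ++ leavesL cs

-- Phylogenetic shape: every inner vertex (incl. the root) has ≥ 2 children
-- (i.e. root degree ≥ 2, non-root inner vertices degree ≥ 3).
mutual
  Phylo : Tree → Set
  Phylo (leaf x) = ⊤
  Phylo (node cs) = (2 ≤ length cs) × PhyloL cs

  PhyloL : List Child → Set
  PhyloL [] = ⊤
  PhyloL ((l , c) ∷ cs) = Phylo c × PhyloL cs

mutual
  LabelsOK : ℕ → List ℕ → Tree → Set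
  LabelsOK k M (leaf x) = ⊤
  LabelsOK k M (node cs) = LabelsOKL k M cs

  LabelsOKL : ℕ → List ℕ → List Child → Set
  LabelsOKL k M [] = ⊤
  LabelsOKL k M ((l , c) ∷ cs) =
    (Σ (List ℕ) λ l' → (∀ a → a ∈ l ⇔ a ∈ l') × length l' ≤ k × All (_∈ M) l')
    × LabelsOK k M c × LabelsOKL k M cs

label : Child → List ℕ
label = proj₁

sub : Child → Tree
sub = proj₂

data RootPathHas (m : ℕ) : Tree → ℕ → Set where
  here  : ∀ {cs y} (i : Fin (length cs)) → y ∈ leaves (sub (lookup cs i)) →
          m ∈ label (lookup cs i) → RootPathHas m (node cs) y
  there : ∀ {cs y} (i : Fin (length cs)) →
          RootPathHas m (sub (lookup cs i)) y → RootPathHas m (node cs) y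

data LcaPathHas (m : ℕ) : Tree → ℕ → ℕ → Set where
  split : ∀ {cs x y} (i j : Fin (length cs)) → i ≢ j →
          x ∈ leaves (sub (lookup cs i)) → y ∈ leaves (sub (lookup cs j)) →
          (m ∈ label (lookup cs j) ⊎ RootPathHas m (sub (lookup cs j)) y) →
          LcaPathHas m (node cs) x y
  down  : ∀ {cs x y} (i : Fin (length cs)) →
          x ∈ leaves (sub (lookup cs i)) → y ∈ leaves (sub (lookup cs i)) →
          LcaPathHas m (sub (lookup cs i)) x y → LcaPathHas m (node cs) x y

-- A map ε : X^×_irr → P(M) with X, M finite nonempty subsets of ℕ.
-- Values of ε outside X^×_irr are irrelevant.
record Map : Set where
  field
    X        : List ℕ
    M        : List ℕ
    X-unique : Unique X
    M-unique : Unique M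
    X-nonempty : X ≢ []
    M-nonempty : M ≢ []
    ε        : ℕ → ℕ → List ℕ
    ε-range  : ∀ x y → x ∈ X → y ∈ X → x ≢ y → All (_∈ M) (ε x y)

open Map public

Explains : Tree → Map → Set
Explains T e = ∀ x y → x ∈ X e → y ∈ X e → x ≢ y →
  ∀ m → m ∈ M e → (m ∈ ε e x y ⇔ LcaPathHas m T x y)

KFitch : ℕ → Map → Set
KFitch k e = Σ Tree λ T →
  Phylo T × (leaves T ↭ X e) × LabelsOK k (M e) T × Explains T e

Submap : Map → Map → Set
Submap e' e = (∀ x → x ∈ X e' → x ∈ X e) ×
  (∀ x y → x ∈ X e' → y ∈ X e' → x ≢ y → ∀ m → m ∈ ε e' x y → m ∈ ε e x y)

ContainsFrom : (Map → Set) → Map → Set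
ContainsFrom F e = Σ Map λ e' → F e' × Submap e' e

module Submission where

open import Defs
open import Data.Nat using (ℕ; suc; _≤_; z≤n; s≤s)
open import Data.Nat.Properties using (≤-trans; ≤-reflexive; +-mono-≤; 1+n≰n; >⇒≢; _≟_)
open import Data.Fin using (zero; suc)
open import Data.List using (List; []; _∷_; _++_; length; upTo; applyUpTo; removeAt)
open import Data.List.Properties using (length-++; ++-identityʳ; length-upTo; length-applyUpTo; length-removeAt′)
open import Data.List.Membership.Propositional using (_∈_)
open import Data.List.Relation.Binary.Subset.Propositional using (_⊆_)
open import Data.List.Relation.Binary.Subset.Propositional.Properties using (xs⊆xs++ys)
open import Data.List.Relation.Unary.Any using (here; there; index)
open import Data.List.Relation.Unary.All as All using (All; []; _∷_)
open import Data.List.Relation.Unary.AllPairs using ([]; _∷_)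
open import Data.List.Relation.Unary.Unique.Propositional using (Unique)
open import Data.List.Relation.Unary.Unique.Propositional.Properties using (upTo⁺)
open import Data.List.Relation.Binary.Permutation.Propositional using (↭-refl)
open import Data.List.Relation.Binary.Permutation.Propositional.Properties using (↭-length)
open import Data.Product using (Σ; _×_; _,_)
open import Data.Sum using (_⊎_; inj₁; inj₂; [_,_]′)
open import Data.Unit using (tt)
open import Data.Empty using (⊥-elim)
open import Relation.Binary.PropositionalEquality using (_≡_; _≢_; refl; sym; cong; subst)
open import Relation.Nullary using (¬_; yes; no)
open import Function.Base using (_∘_)
open import Function.Bundles using (_⇔_; mk⇔; Equivalence)
open import Function.Construct.Identity using (⇔-id)

-- A family characterised by forbidden submaps is closed under taking submaps,
-- since a forbidden submap of a submap is a forbidden submap of the whole map.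
-- The k-restricted Fitch maps are not: on leaves 0, 1, 2 let ε(0,1) = {0,…,k},
-- ε(0,2) = {0}, ε(2,1) = {1,…,k}.  It is explained by the tree (0,(1,2)) with
-- colour 0 on the edge above the cherry and colours 1,…,k on the edge above 1.
-- Its restriction to {0,1} is not: the only phylogenetic tree on two leaves is
-- a cherry, so the edge above 1 would have to carry all k+1 colours.

Submap-trans : ∀ {e₁ e₂ e₃} → Submap e₁ e₂ → Submap e₂ e₃ → Submap e₁ e₃
Submap-trans (X₁⊆X₂ , ε₁⊆ε₂) (X₂⊆X₃ , ε₂⊆ε₃) =
  (λ x x∈ → X₂⊆X₃ x (X₁⊆X₂ x x∈)) ,
  λ x y x∈ y∈ x≢y m m∈ →
    ε₂⊆ε₃ x y (X₁⊆X₂ x x∈) (X₁⊆X₂ y y∈) x≢y m (ε₁⊆ε₂ x y x∈ y∈ x≢y m m∈)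

SubmapClosed : (Map → Set) → Set
SubmapClosed P = ∀ {e e′} → Submap e′ e → P e → P e′

forbiddenSubmaps⇒SubmapClosed : ∀ {P F : Map → Set} →
  (∀ e → P e ⇔ (¬ ContainsFrom F e)) → SubmapClosed P
forbiddenSubmaps⇒SubmapClosed characterises {e} {e′} e′⊆e Pe =
  Equivalence.from (characterises e′) λ (f , f∈F , f⊆e′) →
    Equivalence.to (characterises e) Pe (f , f∈F , Submap-trans {f} {e′} {e} f⊆e′ e′⊆e)

restrict : (e : Map) (X′ : List ℕ) → Unique X′ → X′ ≢ [] → X′ ⊆ X e → Map
restrict e X′ X′-unique X′-nonempty X′⊆X = record
  { X = X′ ; M = M e ; X-unique = X′-unique ; M-unique = M-unique e
  ; X-nonempty = X′-nonempty ; M-nonempty = M-nonempty e ; ε = ε e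
  ; ε-range = λ x y x∈ y∈ → ε-range e x y (X′⊆X x∈) (X′⊆X y∈) }

restrict-Submap : ∀ e X′ u n (X′⊆X : X′ ⊆ X e) → Submap (restrict e X′ u n X′⊆X) e
restrict-Submap e X′ _ _ X′⊆X = (λ _ x∈ → X′⊆X x∈) , λ _ _ _ _ _ _ m∈ → m∈

∈-removeAt : ∀ {A : Set} {x z : A} {ys} (x∈ys : x ∈ ys) →
  z ∈ ys → z ≢ x → z ∈ removeAt ys (index x∈ys)
∈-removeAt (here refl) (here refl) z≢x = ⊥-elim (z≢x refl)
∈-removeAt (here refl) (there z∈) _   = z∈
∈-removeAt (there _)   (here refl) _   = here refl
∈-removeAt (there x∈)  (there z∈) z≢x = there (∈-removeAt x∈ z∈ z≢x)

Unique-⊆⇒length≤ : ∀ {A : Set} {xs ys : List A} → Unique xs → xs ⊆ ys → length xs ≤ length ys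
Unique-⊆⇒length≤ {xs = []} _ _ = z≤n
Unique-⊆⇒length≤ {xs = x ∷ xs} {ys} (x∉xs ∷ xs-unique) xs⊆ys =
  subst (_ ≤_) (sym (length-removeAt′ ys (index x∈ys)))
    (s≤s (Unique-⊆⇒length≤ xs-unique xs⊆ys-x))
  where
  x∈ys : x ∈ ys
  x∈ys = xs⊆ys (here refl)
  xs⊆ys-x : xs ⊆ removeAt ys (index x∈ys)
  xs⊆ys-x z∈xs = ∈-removeAt x∈ys (xs⊆ys (there z∈xs)) λ z≡x → All.lookup x∉xs z∈xs (sym z≡x)

LabelOK : ℕ → List ℕ → List ℕ → Set
LabelOK k M l = Σ (List ℕ) λ l′ → (∀ a → a ∈ l ⇔ a ∈ l′) × length l′ ≤ k × All (_∈ M) l′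

LabelOK-exact : ∀ {k M l} → length l ≤ k → All (_∈ M) l → LabelOK k M l
LabelOK-exact {l = l} |l|≤k l⊆M = l , (λ _ → ⇔-id _) , |l|≤k , l⊆M

LabelOK⇒length≤ : ∀ {k M C l} → Unique C → C ⊆ l → LabelOK k M l → length C ≤ k
LabelOK⇒length≤ C-unique C⊆l (l′ , l≈l′ , |l′|≤k , _) =
  ≤-trans (Unique-⊆⇒length≤ C-unique (λ {a} a∈C → Equivalence.to (l≈l′ a) (C⊆l a∈C))) |l′|≤k

mutual
  Phylo⇒1≤leaves : ∀ {T} → Phylo T → 1 ≤ length (leaves T)
  Phylo⇒1≤leaves {leaf _} _ = s≤s z≤n
  Phylo⇒1≤leaves {node _} (2≤|cs| , ph) = ≤-trans (s≤s z≤n) (≤-trans 2≤|cs| (PhyloL⇒length≤leaves ph))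

  PhyloL⇒length≤leaves : ∀ {cs} → PhyloL cs → length cs ≤ length (leavesL cs)
  PhyloL⇒length≤leaves {[]} _ = z≤n
  PhyloL⇒length≤leaves {(_ , c) ∷ cs} (ph-c , ph-cs) =
    subst (_ ≤_) (sym (length-++ (leaves c)))
      (+-mono-≤ (Phylo⇒1≤leaves ph-c) (PhyloL⇒length≤leaves ph-cs))

Phylo-node⇒2≤leaves : ∀ {cs} → Phylo (node cs) → 2 ≤ length (leavesL cs)
Phylo-node⇒2≤leaves (2≤|cs| , ph) = ≤-trans 2≤|cs| (PhyloL⇒length≤leaves ph)

cherry : List ℕ → ℕ → List ℕ → ℕ → Tree
cherry l₁ a l₂ b = node ((l₁ , leaf a) ∷ (l₂ , leaf b) ∷ [])

data IsCherry : Tree → Set where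
  is-cherry : ∀ l₁ a l₂ b → IsCherry (cherry l₁ a l₂ b)

Phylo-2-leaves⇒IsCherry : ∀ {T} → Phylo T → length (leaves T) ≡ 2 → IsCherry T
Phylo-2-leaves⇒IsCherry {leaf _} _ ()
Phylo-2-leaves⇒IsCherry {node []} (() , _) _
Phylo-2-leaves⇒IsCherry {node (_ ∷ [])} (s≤s () , _) _
Phylo-2-leaves⇒IsCherry {node ((l₁ , leaf a) ∷ (l₂ , leaf b) ∷ [])} _ _ = is-cherry l₁ a l₂ b
Phylo-2-leaves⇒IsCherry {node cs@(_ ∷ _ ∷ _ ∷ _)} (_ , ph) =
  ⊥-elim ∘ >⇒≢ (≤-trans (s≤s (s≤s (s≤s z≤n))) (PhyloL⇒length≤leaves {cs} ph))
Phylo-2-leaves⇒IsCherry {node ((_ , node cs) ∷ c@(_ , t) ∷ [])} (_ , ph-cs , ph-c , _) =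
  ⊥-elim ∘ >⇒≢ (subst (3 ≤_) (sym (length-++ (leavesL cs) {leaves t ++ []}))
    (+-mono-≤ (Phylo-node⇒2≤leaves {cs} ph-cs) (PhyloL⇒length≤leaves {c ∷ []} (ph-c , tt))))
Phylo-2-leaves⇒IsCherry {node ((_ , leaf _) ∷ (_ , node cs) ∷ [])} (_ , _ , ph-cs , _) =
  ⊥-elim ∘ >⇒≢ (s≤s (subst (2 ≤_) (cong length (sym (++-identityʳ (leavesL cs))))
    (Phylo-node⇒2≤leaves {cs} ph-cs)))

data BinaryLcaPathHas (m : ℕ) (l₁ : List ℕ) (T₁ : Tree) (l₂ : List ℕ) (T₂ : Tree) (x y : ℕ) : Set where
  across₁₂ : x ∈ leaves T₁ → y ∈ leaves T₂ → m ∈ l₂ ⊎ RootPathHas m T₂ y →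
             BinaryLcaPathHas m l₁ T₁ l₂ T₂ x y
  across₂₁ : x ∈ leaves T₂ → y ∈ leaves T₁ → m ∈ l₁ ⊎ RootPathHas m T₁ y →
             BinaryLcaPathHas m l₁ T₁ l₂ T₂ x y
  within₁  : LcaPathHas m T₁ x y → BinaryLcaPathHas m l₁ T₁ l₂ T₂ x y
  within₂  : LcaPathHas m T₂ x y → BinaryLcaPathHas m l₁ T₁ l₂ T₂ x y

binary-lcaPath⁻ : ∀ {m l₁ T₁ l₂ T₂ x y} →
  LcaPathHas m (node ((l₁ , T₁) ∷ (l₂ , T₂) ∷ [])) x y → BinaryLcaPathHas m l₁ T₁ l₂ T₂ x y
binary-lcaPath⁻ (split zero zero i≢j _ _ _)             = ⊥-elim (i≢j refl)
binary-lcaPath⁻ (split zero (suc zero) _ x∈ y∈ path)    = across₁₂ x∈ y∈ path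
binary-lcaPath⁻ (split (suc zero) zero _ x∈ y∈ path)    = across₂₁ x∈ y∈ path
binary-lcaPath⁻ (split (suc zero) (suc zero) i≢j _ _ _) = ⊥-elim (i≢j refl)
binary-lcaPath⁻ (down zero _ _ path)                    = within₁ path
binary-lcaPath⁻ (down (suc zero) _ _ path)              = within₂ path

cherry-rootPath⁻ : ∀ {m l₁ a l₂ b y} → RootPathHas m (cherry l₁ a l₂ b) y →
  (y ≡ a × m ∈ l₁) ⊎ (y ≡ b × m ∈ l₂)
cherry-rootPath⁻ (here zero (here refl) m∈)       = inj₁ (refl , m∈)
cherry-rootPath⁻ (here (suc zero) (here refl) m∈) = inj₂ (refl , m∈)
cherry-rootPath⁻ (there zero ())
cherry-rootPath⁻ (there (suc zero) ())

cherry-lcaPath⁻ : ∀ {m l₁ a l₂ b x y} → LcaPathHas m (cherry l₁ a l₂ b) x y →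
  (x ≡ a × y ≡ b × m ∈ l₂) ⊎ (x ≡ b × y ≡ a × m ∈ l₁)
cherry-lcaPath⁻ path with binary-lcaPath⁻ path
... | across₁₂ (here refl) (here refl) (inj₁ m∈) = inj₁ (refl , refl , m∈)
... | across₂₁ (here refl) (here refl) (inj₁ m∈) = inj₂ (refl , refl , m∈)
... | across₁₂ _ _ (inj₂ ())
... | across₂₁ _ _ (inj₂ ())
... | within₁ ()
... | within₂ ()

cherry-lcaPath⇒label⊇ : ∀ {C l₁ a l₂ b x y} → x ≢ y →
  (∀ {m} → m ∈ C → LcaPathHas m (cherry l₁ a l₂ b) x y) → C ⊆ l₁ ⊎ C ⊆ l₂
cherry-lcaPath⇒label⊇ {a = a} {x = x} x≢y paths with a ≟ x
... | yes refl = inj₂ λ m∈C → [ (λ (_ , _ , m∈l₂) → m∈l₂) , (λ (_ , y≡x , _) → ⊥-elim (x≢y (sym y≡x))) ]′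
                                (cherry-lcaPath⁻ (paths m∈C))
... | no a≢x   = inj₁ λ m∈C → [ (λ (x≡a , _) → ⊥-elim (a≢x (sym x≡a))) , (λ (_ , _ , m∈l₁) → m∈l₁) ]′
                                (cherry-lcaPath⁻ (paths m∈C))

colours : ℕ → List ℕ
colours k = upTo (suc k)

positiveColours : ℕ → List ℕ
positiveColours k = applyUpTo suc k

LabelOK⇒colours⊈ : ∀ {k M l} → LabelOK k M l → ¬ (colours k ⊆ l)
LabelOK⇒colours⊈ {k} ok colours⊆l =
  1+n≰n (subst (_≤ k) (length-upTo (suc k)) (LabelOK⇒length≤ (upTo⁺ (suc k)) colours⊆l ok))

witnessLeaves : List ℕ
witnessLeaves = 0 ∷ 1 ∷ 2 ∷ []

witnessε : ℕ → ℕ → ℕ → List ℕ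
witnessε k 0 1 = colours k
witnessε k 0 2 = 0 ∷ []
witnessε k 2 1 = positiveColours k
witnessε k _ _ = []

witnessε⊆colours : ∀ {k x y} → x ∈ witnessLeaves → y ∈ witnessLeaves → witnessε k x y ⊆ colours k
witnessε⊆colours (here refl)                 (there (here refl))         m∈          = m∈
witnessε⊆colours (here refl)                 (there (there (here refl))) (here refl) = here refl
witnessε⊆colours (there (there (here refl))) (there (here refl))         m∈          = there m∈
witnessε⊆colours (here refl)                 (here refl)                 ()
witnessε⊆colours (there (here refl))         (here refl)                 ()
witnessε⊆colours (there (here refl))         (there (here refl))         ()
witnessε⊆colours (there (here refl))         (there (there (here refl))) ()
witnessε⊆colours (there (there (here refl))) (here refl)                 ()
witnessε⊆colours (there (there (here refl))) (there (there (here refl))) ()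

witnessMap : ℕ → Map
witnessMap k = record
  { X = witnessLeaves ; M = colours k
  ; X-unique = ((λ ()) ∷ (λ ()) ∷ []) ∷ ((λ ()) ∷ []) ∷ [] ∷ [] ; M-unique = upTo⁺ (suc k)
  ; X-nonempty = λ () ; M-nonempty = λ () ; ε = witnessε k
  ; ε-range = λ x y x∈ y∈ _ → All.tabulate (witnessε⊆colours x∈ y∈) }

innerCherry : ℕ → Tree
innerCherry k = cherry (positiveColours k) 1 [] 2

witnessTree : ℕ → Tree
witnessTree k = node (([] , leaf 0) ∷ ((0 ∷ []) , innerCherry k) ∷ [])

innerCherry-rootPath⁻ : ∀ {k m y} → RootPathHas m (innerCherry k) y → m ∈ witnessε k 0 y
innerCherry-rootPath⁻ path with cherry-rootPath⁻ path
... | inj₁ (refl , m∈) = there m∈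
... | inj₂ (refl , ())

innerCherry-lcaPath⁻ : ∀ {k m x y} → LcaPathHas m (innerCherry k) x y → m ∈ witnessε k x y
innerCherry-lcaPath⁻ path with cherry-lcaPath⁻ path
... | inj₁ (refl , refl , ())
... | inj₂ (refl , refl , m∈) = m∈

witnessTree-lcaPath⁻ : ∀ {k m x y} → LcaPathHas m (witnessTree k) x y → m ∈ witnessε k x y
witnessTree-lcaPath⁻ path with binary-lcaPath⁻ path
... | across₁₂ (here refl) (here refl)         (inj₁ (here refl)) = here refl
... | across₁₂ (here refl) (there (here refl)) (inj₁ m∈)         = m∈
... | across₁₂ (here refl) _                   (inj₂ path′)      = innerCherry-rootPath⁻ path′
... | across₂₁ _ (here refl) (inj₁ ())
... | across₂₁ _ _           (inj₂ ())
... | within₁ ()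
... | within₂ path′ = innerCherry-lcaPath⁻ path′

witnessTree-lcaPath⁺ : ∀ {k m x y} → x ∈ witnessLeaves → y ∈ witnessLeaves →
  m ∈ witnessε k x y → LcaPathHas m (witnessTree k) x y
witnessTree-lcaPath⁺ (here refl) (there (here refl)) (here refl) =
  split zero (suc zero) (λ ()) (here refl) (here refl) (inj₁ (here refl))
witnessTree-lcaPath⁺ (here refl) (there (here refl)) (there m∈) =
  split zero (suc zero) (λ ()) (here refl) (here refl) (inj₂ (here zero (here refl) m∈))
witnessTree-lcaPath⁺ (here refl) (there (there (here refl))) m∈ =
  split zero (suc zero) (λ ()) (here refl) (there (here refl)) (inj₁ m∈)
witnessTree-lcaPath⁺ (there (there (here refl))) (there (here refl)) m∈ =
  down (suc zero) (there (here refl)) (here refl)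
    (split (suc zero) zero (λ ()) (here refl) (here refl) (inj₁ m∈))
witnessTree-lcaPath⁺ (here refl)                 (here refl)                 ()
witnessTree-lcaPath⁺ (there (here refl))         (here refl)                 ()
witnessTree-lcaPath⁺ (there (here refl))         (there (here refl))         ()
witnessTree-lcaPath⁺ (there (here refl))         (there (there (here refl))) ()
witnessTree-lcaPath⁺ (there (there (here refl))) (here refl)                 ()
witnessTree-lcaPath⁺ (there (there (here refl))) (there (there (here refl))) ()

witnessMap-KFitch : ∀ k → 1 ≤ k → KFitch k (witnessMap k)
witnessMap-KFitch k 1≤k =
  witnessTree k ,
  (s≤s (s≤s z≤n) , tt , (s≤s (s≤s z≤n) , tt , tt , tt) , tt) ,
  ↭-refl ,
  (LabelOK-exact z≤n [] , tt ,
    (LabelOK-exact 1≤k (here refl ∷ []) ,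
      (LabelOK-exact (≤-reflexive (length-applyUpTo suc k)) (All.tabulate there) , tt ,
       LabelOK-exact z≤n [] , tt , tt) ,
     tt)) ,
  λ x y x∈ y∈ _ m _ → mk⇔ (witnessTree-lcaPath⁺ x∈ y∈) witnessTree-lcaPath⁻

pairLeaves : List ℕ
pairLeaves = 0 ∷ 1 ∷ []

pairLeaves-unique : Unique pairLeaves
pairLeaves-unique = ((λ ()) ∷ []) ∷ [] ∷ []

pairLeaves-nonempty : pairLeaves ≢ []
pairLeaves-nonempty ()

pairLeaves⊆witnessLeaves : pairLeaves ⊆ witnessLeaves
pairLeaves⊆witnessLeaves = xs⊆xs++ys pairLeaves (2 ∷ [])

witnessRestriction : ℕ → Map
witnessRestriction k =
  restrict (witnessMap k) pairLeaves pairLeaves-unique pairLeaves-nonempty pairLeaves⊆witnessLeaves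

witnessRestriction-Submap : ∀ k → Submap (witnessRestriction k) (witnessMap k)
witnessRestriction-Submap k =
  restrict-Submap (witnessMap k) pairLeaves pairLeaves-unique pairLeaves-nonempty pairLeaves⊆witnessLeaves

witnessRestriction-not-KFitch : ∀ k → ¬ KFitch k (witnessRestriction k)
witnessRestriction-not-KFitch k (_ , phylo , leaves↭ , labels , explains)
  with Phylo-2-leaves⇒IsCherry phylo (↭-length leaves↭) | labels
... | is-cherry _ _ _ _ | (ok₁ , _ , ok₂ , _ , _) =
  [ LabelOK⇒colours⊈ ok₁ , LabelOK⇒colours⊈ ok₂ ]′
    (cherry-lcaPath⇒label⊇ {C = colours k} (λ ()) λ m∈ →
      Equivalence.to (explains 0 1 (here refl) (there (here refl)) (λ ()) _ m∈) m∈)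

theorem5 : (k : ℕ) → 1 ≤ k →
    ¬ (Σ (Map → Set) λ F → (e : Map) → KFitch k e ⇔ (¬ ContainsFrom F e))
theorem5 k 1≤k (_ , characterises) =
  witnessRestriction-not-KFitch k
    (forbiddenSubmaps⇒SubmapClosed characterises {witnessMap k} {witnessRestriction k}
      (witnessRestriction-Submap k) (witnessMap-KFitch k 1≤k))
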